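{- For all integers $n\ge1$ and $k\ge1$, the metric dimension of the $k$-supertoken graph of the complete graph satisfies $\dim(\mathcal{F}_k(K_n))\le n-1$.
   Context: For a graph $G$ with vertex set $\{1,\ldots,n\}$ and $k\ge1$, the $k$-supertoken graph $\mathcal{F}_k(G)$ has as vertices all vectors $\mathbf{x}=(x_1,\ldots,x_n)$ of nonnegative integers with $\sum_i x_i=k$, with $\mathbf{x},\mathbf{y}$ adjacent iff $\mathbf{y}=\mathbf{x}-\mathbf{e}_i+\mathbf{e}_j$ for some edge $\{i,j\}$ of $G$ with $x_i\ge1$. A vertex subset $C=\{z_1,\ldots,z_c\}$ is a resolving set if every vertex $u$ is uniquely determined by $(\operatorname{dist}(u,z_1),\ldots,\operatorname{dist}(u,z_c))$; the metric dimension is the minimum size of a resolving set. -}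

module Defs where

open import Data.Nat using (ℕ; zero; suc; _+_; _≤_; _<_; _∸_)
open import Data.Fin using (Fin)
open import Data.Fin.Properties using (_≟_)
open import Data.Vec using (Vec; lookup; sum)
open import Data.Product using (Σ; ∃; _×_; _,_)
open import Relation.Nullary using (¬_; does)
open import Relation.Binary.PropositionalEquality using (_≡_; _≢_)
open import Data.Bool using (if_then_else_)

record Graph : Set₁ where
  field
    V   : Set
    Adj : V → V → Set
open Graph public

data Walk (G : Graph) : V G → V G → ℕ → Set where
  nil  : ∀ {u} → Walk G u u 0
  cons : ∀ {u w v d} → Adj G u w → Walk G w v d → Walk G u v (suc d)

IsDist : (G : Graph) → V G → V G → ℕ → Set
IsDist G u v d = Walk G u v d × (∀ d' → d' < d → ¬ Walk G u v d')

Resolving : (G : Graph) {c : ℕ} → (Fin c → V G) → Set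
Resolving G {c} z =
  ∀ u w → (∀ i d → (IsDist G u (z i) d → IsDist G w (z i) d)
                 × (IsDist G w (z i) d → IsDist G u (z i) d))
        → u ≡ w

MetricDimension≤ : Graph → ℕ → Set
MetricDimension≤ G m = Σ ℕ λ c → c ≤ m × Σ (Fin c → V G) λ z → Resolving G z

δ : ∀ {n} → Fin n → Fin n → ℕ
δ i l = if does (i ≟ l) then 1 else 0

KAdj : (n : ℕ) → Fin n → Fin n → Set
KAdj n i j = i ≢ j

-- k-supertoken graph of a graph on Fin n with edge relation E:
-- vertices are x ∈ ℕ^n with Σ x_i = k; x ~ y iff y = x − e_i + e_j
-- for some edge {i,j} with x_i ≥ 1 (written coordinatewise without ∸).
SuperVertex : ℕ → ℕ → Set
SuperVertex n k = Σ (Vec ℕ n) λ x → sum x ≡ k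

SuperAdj : (n k : ℕ) → (Fin n → Fin n → Set) → SuperVertex n k → SuperVertex n k → Set
SuperAdj n k E (x , _) (y , _) =
  Σ (Fin n) λ i → Σ (Fin n) λ j →
    E i j × 1 ≤ lookup x i × (∀ l → lookup y l + δ i l ≡ lookup x l + δ j l)

SupertokenGraph : (n k : ℕ) → (Fin n → Fin n → Set) → Graph
SupertokenGraph n k E = record { V = SuperVertex n k ; Adj = SuperAdj n k E }

-- The k-fold concentrations k·e_t are landmarks: in F_k(K_n) the distance
-- from x to k·e_t is k − x_t, since one move shifts at most one token onto
-- t, and moving any token sitting elsewhere onto t is always allowed in K_n.
-- Hence the landmarks k·e_2, …, k·e_n recover x_2, …, x_n, and x_1 is then
-- fixed by x_1 + … + x_n = k.
module Submission where

open import Defs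
open import Data.Nat using (ℕ; zero; suc; _+_; _*_; _∸_; _≤_; _<_; z≤n; s≤s)
open import Data.Nat.Properties
open import Data.Fin using (Fin; zero; suc)
open import Data.Fin.Properties using () renaming (_≟_ to _≟ᶠ_)
open import Data.Vec using (Vec; []; _∷_; lookup; sum; tabulate; map; zipWith)
open import Data.Vec.Properties using (lookup∘tabulate; tabulate∘lookup; tabulate-cong; lookup-map; lookup-zipWith)
open import Data.Product using (Σ; _×_; _,_; proj₁)
open import Data.Empty using (⊥-elim)
open import Relation.Nullary using (¬_; yes; no)
open import Relation.Binary.PropositionalEquality
open import Relation.Binary.Definitions using (tri<; tri≈; tri>)
open import Algebra.Properties.CommutativeSemigroup +-commutativeSemigroup using (interchange; xy∙z≈xz∙y)

IsDist-functional : ∀ {G : Graph} {u v : V G} {d e : ℕ} → IsDist G u v d → IsDist G u v e → d ≡ e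
IsDist-functional {d = d} {e} (walk-d , d-minimal) (walk-e , e-minimal) with <-cmp d e
... | tri< d<e _ _ = ⊥-elim (e-minimal d d<e walk-d)
... | tri≈ _ d≡e _ = d≡e
... | tri> _ _ e<d = ⊥-elim (d-minimal e e<d walk-e)

δ-diag : ∀ {n} (t : Fin n) → δ t t ≡ 1
δ-diag t with t ≟ᶠ t
... | yes _ = refl
... | no t≢t = ⊥-elim (t≢t refl)

δ-≢ : ∀ {n} {i l : Fin n} → i ≢ l → δ i l ≡ 0
δ-≢ {i = i} {l} i≢l with i ≟ᶠ l
... | yes i≡l = ⊥-elim (i≢l i≡l)
... | no _ = refl

δ≤1 : ∀ {n} (i l : Fin n) → δ i l ≤ 1
δ≤1 i l with i ≟ᶠ l
... | yes _ = s≤s z≤n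
... | no _ = z≤n

lookup-ext : ∀ {a n} {A : Set a} {xs ys : Vec A n} → (∀ i → lookup xs i ≡ lookup ys i) → xs ≡ ys
lookup-ext {xs = xs} {ys} eq =
  trans (sym (tabulate∘lookup xs)) (trans (tabulate-cong eq) (tabulate∘lookup ys))

sum-zipWith-+ : ∀ {n} (xs ys : Vec ℕ n) → sum (zipWith _+_ xs ys) ≡ sum xs + sum ys
sum-zipWith-+ [] [] = refl
sum-zipWith-+ (x ∷ xs) (y ∷ ys) =
  trans (cong (x + y +_) (sum-zipWith-+ xs ys)) (interchange x y (sum xs) (sum ys))

sum-cong-+ : ∀ {n} (a b c d : Vec ℕ n) → (∀ l → lookup a l + lookup b l ≡ lookup c l + lookup d l) →
             sum a + sum b ≡ sum c + sum d
sum-cong-+ a b c d eq = begin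
  sum a + sum b            ≡⟨ sum-zipWith-+ a b ⟨
  sum (zipWith _+_ a b)    ≡⟨ cong sum zipWith≡ ⟩
  sum (zipWith _+_ c d)    ≡⟨ sum-zipWith-+ c d ⟩
  sum c + sum d            ∎
  where
  open ≡-Reasoning
  zipWith≡ : zipWith _+_ a b ≡ zipWith _+_ c d
  zipWith≡ = lookup-ext λ l → trans (lookup-zipWith _+_ l a b) (trans (eq l) (sym (lookup-zipWith _+_ l c d)))

sum-map-*ˡ : ∀ {n} (k : ℕ) (xs : Vec ℕ n) → sum (map (k *_) xs) ≡ k * sum xs
sum-map-*ˡ k [] = sym (*-zeroʳ k)
sum-map-*ˡ k (x ∷ xs) = trans (cong (k * x +_) (sum-map-*ˡ k xs)) (sym (*-distribˡ-+ k x (sum xs)))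

lookup≤sum : ∀ {n} (xs : Vec ℕ n) (t : Fin n) → lookup xs t ≤ sum xs
lookup≤sum (x ∷ xs) zero = m≤m+n x (sum xs)
lookup≤sum (x ∷ xs) (suc t) = ≤-trans (lookup≤sum xs t) (m≤n+m (sum xs) x)

lookup+lookup≤sum : ∀ {n} (xs : Vec ℕ n) {t l : Fin n} → t ≢ l → lookup xs t + lookup xs l ≤ sum xs
lookup+lookup≤sum (x ∷ xs) {zero} {zero} t≢l = ⊥-elim (t≢l refl)
lookup+lookup≤sum (x ∷ xs) {zero} {suc l} _ = +-monoʳ-≤ x (lookup≤sum xs l)
lookup+lookup≤sum (x ∷ xs) {suc t} {zero} _ =
  subst (_≤ x + sum xs) (+-comm x (lookup xs t)) (+-monoʳ-≤ x (lookup≤sum xs t))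
lookup+lookup≤sum (x ∷ xs) {suc t} {suc l} t≢l =
  ≤-trans (lookup+lookup≤sum xs (λ t≡l → t≢l (cong suc t≡l))) (m≤n+m (sum xs) x)

nonzero-entry : ∀ {n} (xs : Vec ℕ n) → 0 < sum xs → Σ (Fin n) λ j → 1 ≤ lookup xs j
nonzero-entry (zero ∷ xs) 0<Σ with nonzero-entry xs 0<Σ
... | j , 1≤xj = suc j , 1≤xj
nonzero-entry (suc x ∷ xs) _ = zero , s≤s z≤n

nonzero-entry-elsewhere : ∀ {n} (xs : Vec ℕ n) (t : Fin n) → lookup xs t < sum xs →
                          Σ (Fin n) λ j → j ≢ t × 1 ≤ lookup xs j
nonzero-entry-elsewhere (x ∷ xs) zero x<x+Σ with nonzero-entry xs 0<Σ
  where
  0<Σ : 0 < sum xs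
  0<Σ = +-cancelˡ-< x 0 (sum xs) (subst (_< x + sum xs) (sym (+-identityʳ x)) x<x+Σ)
... | j , 1≤xj = suc j , (λ ()) , 1≤xj
nonzero-entry-elsewhere (suc x ∷ xs) (suc t) _ = zero , (λ ()) , s≤s z≤n
nonzero-entry-elsewhere (zero ∷ xs) (suc t) xt<Σ with nonzero-entry-elsewhere xs t xt<Σ
... | j , j≢t , 1≤xj = suc j , (λ { refl → j≢t refl }) , 1≤xj

unit : ∀ {n} → Fin n → Vec ℕ n
unit t = tabulate (δ t)

sum-unit : ∀ {n} (t : Fin n) → sum (unit t) ≡ 1
sum-unit {suc n} zero = cong suc (sum-zeros n)
  where
  sum-zeros : ∀ m → sum (tabulate {m} (λ _ → 0)) ≡ 0
  sum-zeros zero = refl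
  sum-zeros (suc m) = sum-zeros m
sum-unit {suc n} (suc t) = sum-unit t

tokens : ∀ {n k} → SuperVertex n k → Vec ℕ n
tokens = proj₁

SuperVertex-≡ : ∀ {n k} {x y : SuperVertex n k} → tokens x ≡ tokens y → x ≡ y
SuperVertex-≡ {x = xs , p} {.xs , q} refl = cong (xs ,_) (≡-irrelevant p q)

SuperVertex-≡-fromTail : ∀ {n k} (x y : SuperVertex (suc n) k) →
  (∀ i → lookup (tokens x) (suc i) ≡ lookup (tokens y) (suc i)) → x ≡ y
SuperVertex-≡-fromTail (a ∷ xs , a+Σxs≡k) (b ∷ ys , b+Σys≡k) tails≡ =
  SuperVertex-≡ (cong₂ _∷_ a≡b xs≡ys)
  where
  xs≡ys : xs ≡ ys
  xs≡ys = lookup-ext tails≡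
  a≡b : a ≡ b
  a≡b = +-cancelʳ-≡ (sum xs) a b (trans a+Σxs≡k (trans (sym b+Σys≡k) (cong (λ zs → b + sum zs) (sym xs≡ys))))

lookup≤k : ∀ {n k} (x : SuperVertex n k) (t : Fin n) → lookup (tokens x) t ≤ k
lookup≤k (xs , Σxs≡k) t = subst (lookup xs t ≤_) Σxs≡k (lookup≤sum xs t)

corner : ∀ {n} (k : ℕ) → Fin n → SuperVertex n k
corner k t = map (k *_) (unit t) , trans (sum-map-*ˡ k (unit t)) (trans (cong (k *_) (sum-unit t)) (*-identityʳ k))

lookup-corner : ∀ {n} k (t l : Fin n) → lookup (tokens (corner k t)) l ≡ k * δ t l
lookup-corner k t l = trans (lookup-map l (k *_) (unit t)) (cong (k *_) (lookup∘tabulate (δ t) l))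

lookup-corner-diag : ∀ {n} k (t : Fin n) → lookup (tokens (corner k t)) t ≡ k
lookup-corner-diag k t = trans (lookup-corner k t t) (trans (cong (k *_) (δ-diag t)) (*-identityʳ k))

lookup≡k⇒corner : ∀ {n k} (x : SuperVertex n k) (t : Fin n) → lookup (tokens x) t ≡ k → x ≡ corner k t
lookup≡k⇒corner {k = k} (xs , Σxs≡k) t xt≡k = SuperVertex-≡ (lookup-ext coordinate)
  where
  coordinate : ∀ l → lookup xs l ≡ lookup (tokens (corner k t)) l
  coordinate l with t ≟ᶠ l
  ... | yes refl = trans xt≡k (sym (lookup-corner-diag k t))
  ... | no t≢l = trans xl≡0 (sym (trans (lookup-corner k t l) (trans (cong (k *_) (δ-≢ t≢l)) (*-zeroʳ k))))
    where
    xl≡0 : lookup xs l ≡ 0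
    xl≡0 = n≤0⇒n≡0 (+-cancelˡ-≤ (lookup xs t) _ 0
      (subst (lookup xs t + lookup xs l ≤_) (trans Σxs≡k (sym (trans (+-identityʳ _) xt≡k)))
        (lookup+lookup≤sum xs t≢l)))

module _ {n k : ℕ} {E : Fin n → Fin n → Set} where

  private
    G : Graph
    G = SupertokenGraph n k E

  Adj-lookup-≤ : ∀ (t : Fin n) {x y : SuperVertex n k} → Adj G x y → lookup (tokens y) t ≤ suc (lookup (tokens x) t)
  Adj-lookup-≤ t {xs , _} {ys , _} (i , j , _ , _ , balance) = begin
    lookup ys t               ≤⟨ m≤m+n (lookup ys t) (δ i t) ⟩
    lookup ys t + δ i t       ≡⟨ balance t ⟩
    lookup xs t + δ j t       ≤⟨ +-monoʳ-≤ (lookup xs t) (δ≤1 j t) ⟩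
    lookup xs t + 1           ≡⟨ +-comm (lookup xs t) 1 ⟩
    suc (lookup xs t)         ∎
    where open ≤-Reasoning

  Walk-lookup-≤ : ∀ (t : Fin n) {x y : SuperVertex n k} {d : ℕ} → Walk G x y d →
                  lookup (tokens y) t ≤ lookup (tokens x) t + d
  Walk-lookup-≤ t nil = m≤m+n _ 0
  Walk-lookup-≤ t {x} {y} (cons {w = w} {d = d} x~w walk) = begin
    lookup (tokens y) t             ≤⟨ Walk-lookup-≤ t walk ⟩
    lookup (tokens w) t + d         ≤⟨ +-monoˡ-≤ d (Adj-lookup-≤ t {x} {w} x~w) ⟩
    suc (lookup (tokens x) t) + d   ≡⟨ +-suc (lookup (tokens x) t) d ⟨
    lookup (tokens x) t + suc d     ∎
    where open ≤-Reasoning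

  moveToken : ∀ (x : SuperVertex n k) {j t : Fin n} → E j t → j ≢ t → 1 ≤ lookup (tokens x) j →
              Σ (SuperVertex n k) λ y → Adj G x y × lookup (tokens y) t ≡ suc (lookup (tokens x) t)
  moveToken (xs , Σxs≡k) {j} {t} j~t j≢t 1≤xj = (ys , Σys≡k) , (j , t , j~t , 1≤xj , balance) , yt≡1+xt
    where
    ys : Vec ℕ n
    ys = tabulate (λ l → lookup xs l ∸ δ j l + δ t l)

    δj≤xs : ∀ l → δ j l ≤ lookup xs l
    δj≤xs l with j ≟ᶠ l
    ... | yes refl = 1≤xj
    ... | no _ = z≤n

    balance : ∀ l → lookup ys l + δ j l ≡ lookup xs l + δ t l
    balance l = begin
      lookup ys l + δ j l                          ≡⟨ cong (_+ δ j l) (lookup∘tabulate _ l) ⟩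
      lookup xs l ∸ δ j l + δ t l + δ j l          ≡⟨ xy∙z≈xz∙y (lookup xs l ∸ δ j l) (δ t l) (δ j l) ⟩
      lookup xs l ∸ δ j l + δ j l + δ t l          ≡⟨ cong (_+ δ t l) (m∸n+n≡m (δj≤xs l)) ⟩
      lookup xs l + δ t l                          ∎
      where open ≡-Reasoning

    Σys≡k : sum ys ≡ k
    Σys≡k = +-cancelʳ-≡ 1 (sum ys) k (begin
      sum ys + 1                  ≡⟨ cong (sum ys +_) (sum-unit j) ⟨
      sum ys + sum (unit j)       ≡⟨ sum-cong-+ ys (unit j) xs (unit t) balance-unit ⟩
      sum xs + sum (unit t)       ≡⟨ cong₂ _+_ Σxs≡k (sum-unit t) ⟩
      k + 1                       ∎)
      where
      open ≡-Reasoning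
      balance-unit : ∀ l → lookup ys l + lookup (unit j) l ≡ lookup xs l + lookup (unit t) l
      balance-unit l = begin
        lookup ys l + lookup (unit j) l   ≡⟨ cong (lookup ys l +_) (lookup∘tabulate (δ j) l) ⟩
        lookup ys l + δ j l               ≡⟨ balance l ⟩
        lookup xs l + δ t l               ≡⟨ cong (lookup xs l +_) (lookup∘tabulate (δ t) l) ⟨
        lookup xs l + lookup (unit t) l   ∎

    yt≡1+xt : lookup ys t ≡ suc (lookup xs t)
    yt≡1+xt = begin
      lookup ys t                          ≡⟨ lookup∘tabulate _ t ⟩
      lookup xs t ∸ δ j t + δ t t          ≡⟨ cong₂ (λ a b → lookup xs t ∸ a + b) (δ-≢ j≢t) (δ-diag t) ⟩
      lookup xs t + 1                      ≡⟨ +-comm (lookup xs t) 1 ⟩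
      suc (lookup xs t)                    ∎
      where open ≡-Reasoning

module _ {n k : ℕ} where

  private
    K : Graph
    K = SupertokenGraph n k (KAdj n)

  walk-to-corner : ∀ (t : Fin n) (d : ℕ) (x : SuperVertex n k) → lookup (tokens x) t + d ≡ k →
                   Walk K x (corner k t) d
  walk-to-corner t zero x xt+0≡k =
    subst (λ c → Walk K x c 0) (lookup≡k⇒corner x t (trans (sym (+-identityʳ _)) xt+0≡k)) nil
  walk-to-corner t (suc d) x@(xs , Σxs≡k) xt+1+d≡k with nonzero-entry-elsewhere xs t xt<Σ
    where
    xt<Σ : lookup xs t < sum xs
    xt<Σ = subst (lookup xs t <_) (trans xt+1+d≡k (sym Σxs≡k)) (m<m+n (lookup xs t) (s≤s z≤n))
  ... | j , j≢t , 1≤xj with moveToken x j≢t j≢t 1≤xj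
  ... | y , x~y , yt≡1+xt = cons x~y (walk-to-corner t d y yt+d≡k)
    where
    yt+d≡k : lookup (tokens y) t + d ≡ k
    yt+d≡k = trans (cong (_+ d) yt≡1+xt) (trans (sym (+-suc (lookup xs t) d)) xt+1+d≡k)

  dist-to-corner : ∀ (t : Fin n) (x : SuperVertex n k) → IsDist K x (corner k t) (k ∸ lookup (tokens x) t)
  dist-to-corner t x = walk-to-corner t _ x (m+[n∸m]≡n (lookup≤k x t)) , no-shorter
    where
    xt : ℕ
    xt = lookup (tokens x) t
    no-shorter : ∀ d → d < k ∸ xt → ¬ Walk K x (corner k t) d
    no-shorter d d<k∸xt walk = <⇒≱ d<k∸xt (begin
      k ∸ xt                                ≡⟨ cong (_∸ xt) (lookup-corner-diag k t) ⟨
      lookup (tokens (corner k t)) t ∸ xt   ≤⟨ ∸-monoˡ-≤ xt (Walk-lookup-≤ t walk) ⟩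
      xt + d ∸ xt                           ≡⟨ m+n∸m≡n xt d ⟩
      d                                     ∎)
      where open ≤-Reasoning

-- The argument does not need 1 ≤ k.
mainTheorem9 : (n k : ℕ) → 1 ≤ n → 1 ≤ k
    → MetricDimension≤ (SupertokenGraph n k (KAdj n)) (n ∸ 1)
mainTheorem9 (suc m) k _ _ = m , ≤-refl , landmark , resolving
  where
  landmark : Fin m → SuperVertex (suc m) k
  landmark i = corner k (suc i)

  resolving : Resolving (SupertokenGraph (suc m) k (KAdj (suc m))) landmark
  resolving x y same-distances = SuperVertex-≡-fromTail x y coordinate
    where
    coordinate : ∀ i → lookup (tokens x) (suc i) ≡ lookup (tokens y) (suc i)
    coordinate i = ∸-cancelˡ-≡ (lookup≤k x (suc i)) (lookup≤k y (suc i))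
      (IsDist-functional (proj₁ (same-distances i _) (dist-to-corner (suc i) x)) (dist-to-corner (suc i) y))
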